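{- Fix an integer $k\ge 0$, a polynomial $Q\in\mathbb{Z}[y_1,\dots,y_k,m]$ and a sequence $\mathbf r=(r_0,r_1,\dots,r_k)$ of rational numbers. Define $$M(k,Q,\mathbf r,n,x)=\sum_{1\le x_1<x_2<\dots<x_k\le n}Q(x_1,\dots,x_k,n)\prod_{i=0}^k(x+r_i)^{x_{i+1}-x_i-1},$$ with the conventions $x_0=0$ and $x_{k+1}=n+1$. Then $M(k,Q,\mathbf r,n,x)$ is a rational linear combination of terms of the form $$F(n)G(x)(x+r_i)^{n-k},$$ where $F\in\mathbb{Q}[n]$ and $G\in\mathbb{Q}[x]$ are polynomials and $0\le i\le k$. -}

module Defs where

open import Data.Nat as ℕ using (ℕ; zero; suc; _∸_)
open import Data.Integer as ℤ using (ℤ; +_)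
open import Data.Rational using (ℚ; _+_; _*_; 0ℚ; 1ℚ; _/_)
open import Data.Fin using (Fin; zero; suc; inject₁)
open import Data.Vec using (Vec; []; _∷_; _∷ʳ_; lookup)
open import Data.List using (List; []; _∷_; [_]; map; concatMap; upTo; foldr)

_^ℚ_ : ℚ → ℕ → ℚ
q ^ℚ zero  = 1ℚ
q ^ℚ suc e = q * (q ^ℚ e)

ℕ→ℚ : ℕ → ℚ
ℕ→ℚ n = (+ n) / 1

ℤ→ℚ : ℤ → ℚ
ℤ→ℚ z = z / 1

-- Multivariate polynomials with integer coefficients in variables indexed by Fin v
-- (polynomial expressions; every element of ℤ[vars] is represented).
data ℤPoly (v : ℕ) : Set where
  const : ℤ → ℤPoly v
  var   : Fin v → ℤPoly v
  _⊕_   : ℤPoly v → ℤPoly v → ℤPoly v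
  _⊗_   : ℤPoly v → ℤPoly v → ℤPoly v

evalℤPoly : ∀ {v} → ℤPoly v → (Fin v → ℚ) → ℚ
evalℤPoly (const c) ρ = ℤ→ℚ c
evalℤPoly (var i)   ρ = ρ i
evalℤPoly (p ⊕ q)   ρ = evalℤPoly p ρ + evalℤPoly q ρ
evalℤPoly (p ⊗ q)   ρ = evalℤPoly p ρ * evalℤPoly q ρ

-- Univariate polynomials over ℚ as coefficient lists (constant term first).
ℚPoly : Set
ℚPoly = List ℚ

evalℚPoly : ℚPoly → ℚ → ℚ
evalℚPoly cs t = foldr (λ c acc → c + t * acc) 0ℚ cs

range : ℕ → ℕ → List ℕ
range lo hi = map (lo ℕ.+_) (upTo (suc hi ∸ lo))

incSeqs : (k : ℕ) → ℕ → ℕ → List (Vec ℕ k)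
incSeqs zero    lo hi = [ [] ]
incSeqs (suc k) lo hi = concatMap (λ a → map (a ∷_) (incSeqs k (suc a) hi)) (range lo hi)

sumℚ : List ℚ → ℚ
sumℚ = foldr _+_ 0ℚ

prodFin : (m : ℕ) → (Fin m → ℚ) → ℚ
prodFin zero    f = 1ℚ
prodFin (suc m) f = f zero * prodFin m (λ i → f (suc i))

-- Q's variables: y₁..y_k are indices 0..k-1, m is index k.
-- r i corresponds to r_i, i = 0..k.
M : (k : ℕ) → ℤPoly (suc k) → (Fin (suc k) → ℚ) → ℕ → ℚ → ℚ
M k Q r n x = sumℚ (map term (incSeqs k 1 n))
  where
  term : Vec ℕ k → ℚ
  term xs = evalℤPoly Q (λ j → ℕ→ℚ (lookup (xs ∷ʳ n) j))
            * prodFin (suc k) (λ i → (x + r i) ^ℚ (lookup full (suc i) ∸ lookup full (inject₁ i) ∸ 1))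
    where
    full : Vec ℕ (suc (suc k))
    full = 0 ∷ (xs ∷ʳ suc n)

module Submission where

-- Call f(x,N) an exponential polynomial if it is a finite sum of terms
-- F(N) G(x) (x + r i)^N with polynomials F, G.  These are closed under sums,
-- under multiplication by polynomials in x or in N, and -- the heart of the
-- argument -- under convolution with a geometric sequence (x + r j)^N: for
-- r i = r j this is a discrete integral of F, for r i ≠ r j it follows by
-- summation by parts, dividing by r i - r j.  Polynomials in N are kept in the
-- binomial basis (N choose j), where integration and differences are structural.
--
-- To bring M into this form, substitute yⱼ ↦ m + 1 - yⱼ in Q and expand into
-- monomials.  For each monomial the sum over x₁ < … < x_k, peeled at x₁, only
-- depends on n - x₁ and is the iterated convolution W; by induction on k,
-- W (N + k) is an exponential polynomial.  Substituting N = n - k and converting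
-- to the monomial basis in n gives the closed form.

open import Defs
open import Data.Nat as ℕ using (ℕ; zero; suc; _≤_; _<_; _∸_; z≤n; s≤s)
import Data.Nat.Properties as ℕP
import Data.Nat.Coprimality as Coprimality
import Data.Integer as ℤ
import Data.Integer.Properties as ℤP
open import Data.Rational using (ℚ; mkℚ; _/_; _+_; _*_; _-_; -_; 0ℚ; 1ℚ; 1/_; ≢-nonZero)
import Data.Rational.Properties as ℚP
open import Data.Fin using (Fin; zero; suc; fromℕ; inject₁)
open import Data.Vec as Vec using (Vec; []; _∷_; _∷ʳ_; lookup; init; last; initLast)
open import Data.List as List using (List; []; _∷_; [_]; map; _++_; concatMap; applyUpTo; replicate)
import Data.List.Properties as ListP
open import Data.Product using (Σ; ∃; _×_; _,_; proj₁; proj₂)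
open import Data.Maybe using (Maybe; just; nothing)
open import Function using (_∘_)
open import Level using (0ℓ)
open import Relation.Nullary using (yes; no)
open import Relation.Binary.PropositionalEquality hiding ([_])
import Tactic.RingSolver.Core.AlmostCommutativeRing as ACR
open import Tactic.RingSolver using (solve-∀)
open ≡-Reasoning

ℚ-ring : ACR.AlmostCommutativeRing 0ℓ 0ℓ
ℚ-ring = ACR.fromCommutativeRing ℚP.+-*-commutativeRing isZero
  where
  isZero : ∀ q → Maybe (0ℚ ≡ q)
  isZero q with 0ℚ ℚP.≟ q
  ... | yes 0≡q = just 0≡q
  ... | no _    = nothing

private
  +-interchange : ∀ a b c d → (a + b) + (c + d) ≡ (a + c) + (b + d)
  +-interchange = solve-∀ ℚ-ring

  *-reassoc : ∀ a b c d → (a * b) * (c * d) ≡ (a * c) * (b * d)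
  *-reassoc = solve-∀ ℚ-ring

ι : ℕ → ℚ
ι = ℕ→ℚ

ι-mkℚ : ∀ n → ι n ≡ mkℚ (ℤ.+ n) 0 (Coprimality.sym (Coprimality.1-coprimeTo n))
ι-mkℚ n = ℚP.normalize-coprime (Coprimality.sym (Coprimality.1-coprimeTo n))

ι-+ : ∀ m n → ι (m ℕ.+ n) ≡ ι m + ι n
ι-+ m n rewrite ι-mkℚ m | ι-mkℚ n =
  cong (_/ 1) (sym (cong₂ ℤ._+_ (ℤP.*-identityʳ (ℤ.+ m)) (ℤP.*-identityʳ (ℤ.+ n))))

ι-suc : ∀ n → ι (suc n) ≡ ι n + 1ℚ
ι-suc n = trans (ι-+ 1 n) (ℚP.+-comm 1ℚ (ι n))

ι-suc≢0 : ∀ n → ι (suc n) ≢ 0ℚ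
ι-suc≢0 n eq with trans (sym (ι-mkℚ (suc n))) eq
... | ()

recip : (q : ℚ) → q ≢ 0ℚ → ℚ
recip q q≢0 = 1/_ q {{≢-nonZero q≢0}}

recip-cancel : ∀ q (q≢0 : q ≢ 0ℚ) a → recip q q≢0 * (q * a) ≡ a
recip-cancel q q≢0 a = begin
  recip q q≢0 * (q * a)   ≡⟨ reorder (recip q q≢0) q a ⟩
  (q * recip q q≢0) * a   ≡⟨ cong (_* a) (ℚP.*-inverseʳ q {{≢-nonZero q≢0}}) ⟩
  1ℚ * a                  ≡⟨ ℚP.*-identityˡ a ⟩
  a                       ∎
  where
  reorder : ∀ p q a → p * (q * a) ≡ (q * p) * a
  reorder = solve-∀ ℚ-ring

^-+ : ∀ q a b → q ^ℚ (a ℕ.+ b) ≡ q ^ℚ a * q ^ℚ b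
^-+ q zero    b = sym (ℚP.*-identityˡ _)
^-+ q (suc a) b = trans (cong (q *_) (^-+ q a b)) (sym (ℚP.*-assoc q (q ^ℚ a) (q ^ℚ b)))

module _ {A : Set} where

  sum-cong : ∀ {f g : A → ℚ} → (∀ a → f a ≡ g a) → ∀ xs → sumℚ (map f xs) ≡ sumℚ (map g xs)
  sum-cong f≗g xs = cong sumℚ (ListP.map-cong f≗g xs)

  sum-zero : ∀ (xs : List A) → sumℚ (map (λ _ → 0ℚ) xs) ≡ 0ℚ
  sum-zero []       = refl
  sum-zero (x ∷ xs) = trans (cong (0ℚ +_) (sum-zero xs)) (ℚP.+-identityˡ 0ℚ)

  sum-++ : ∀ (f : A → ℚ) xs ys → sumℚ (map f (xs ++ ys)) ≡ sumℚ (map f xs) + sumℚ (map f ys)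
  sum-++ f []       ys = sym (ℚP.+-identityˡ _)
  sum-++ f (x ∷ xs) ys = trans (cong (f x +_) (sum-++ f xs ys)) (sym (ℚP.+-assoc (f x) _ _))

  sum-+ : ∀ (f g : A → ℚ) xs → sumℚ (map (λ a → f a + g a) xs) ≡ sumℚ (map f xs) + sumℚ (map g xs)
  sum-+ f g []       = sym (ℚP.+-identityˡ 0ℚ)
  sum-+ f g (x ∷ xs) = trans (cong (f x + g x +_) (sum-+ f g xs)) (+-interchange (f x) (g x) _ _)

  sum-*ˡ : ∀ c (f : A → ℚ) xs → sumℚ (map (λ a → c * f a) xs) ≡ c * sumℚ (map f xs)
  sum-*ˡ c f []       = sym (ℚP.*-zeroʳ c)
  sum-*ˡ c f (x ∷ xs) = trans (cong (c * f x +_) (sum-*ˡ c f xs)) (sym (ℚP.*-distribˡ-+ c (f x) _))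

  sum-*ʳ : ∀ c (f : A → ℚ) xs → sumℚ (map (λ a → f a * c) xs) ≡ sumℚ (map f xs) * c
  sum-*ʳ c f xs = begin
    sumℚ (map (λ a → f a * c) xs)  ≡⟨ sum-cong (λ a → ℚP.*-comm (f a) c) xs ⟩
    sumℚ (map (λ a → c * f a) xs)  ≡⟨ sum-*ˡ c f xs ⟩
    c * sumℚ (map f xs)            ≡⟨ ℚP.*-comm c _ ⟩
    sumℚ (map f xs) * c            ∎

module _ {A B : Set} where

  sum-map : ∀ (f : B → ℚ) (g : A → B) xs → sumℚ (map f (map g xs)) ≡ sumℚ (map (f ∘ g) xs)
  sum-map f g xs = cong sumℚ (sym (ListP.map-∘ xs))

  sum-concatMap : ∀ (f : B → ℚ) (g : A → List B) xs →
    sumℚ (map f (concatMap g xs)) ≡ sumℚ (map (λ a → sumℚ (map f (g a))) xs)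
  sum-concatMap f g []       = refl
  sum-concatMap f g (x ∷ xs) =
    trans (sum-++ f (g x) (concatMap g xs)) (cong (sumℚ (map f (g x)) +_) (sum-concatMap f g xs))

  sum-swap : ∀ (f : A → B → ℚ) xs ys →
    sumℚ (map (λ a → sumℚ (map (f a) ys)) xs) ≡ sumℚ (map (λ b → sumℚ (map (λ a → f a b) xs)) ys)
  sum-swap f []       ys = sym (sum-zero ys)
  sum-swap f (x ∷ xs) ys = begin
    sumℚ (map (f x) ys) + sumℚ (map (λ a → sumℚ (map (f a) ys)) xs)
      ≡⟨ cong (sumℚ (map (f x) ys) +_) (sum-swap f xs ys) ⟩
    sumℚ (map (f x) ys) + sumℚ (map (λ b → sumℚ (map (λ a → f a b) xs)) ys)
      ≡⟨ sym (sum-+ (f x) (λ b → sumℚ (map (λ a → f a b) xs)) ys) ⟩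
    sumℚ (map (λ b → f x b + sumℚ (map (λ a → f a b) xs)) ys) ∎

sumUpTo : ℕ → (ℕ → ℚ) → ℚ
sumUpTo zero    f = 0ℚ
sumUpTo (suc m) f = f 0 + sumUpTo m (f ∘ suc)

sumUpTo-cong : ∀ m {f g} → (∀ i → i < m → f i ≡ g i) → sumUpTo m f ≡ sumUpTo m g
sumUpTo-cong zero    eq = refl
sumUpTo-cong (suc m) eq = cong₂ _+_ (eq 0 (s≤s z≤n)) (sumUpTo-cong m (λ i i<m → eq (suc i) (s≤s i<m)))

sumUpTo-*ˡ : ∀ m c f → sumUpTo m (λ i → c * f i) ≡ c * sumUpTo m f
sumUpTo-*ˡ zero    c f = sym (ℚP.*-zeroʳ c)
sumUpTo-*ˡ (suc m) c f = trans (cong (c * f 0 +_) (sumUpTo-*ˡ m c (f ∘ suc))) (sym (ℚP.*-distribˡ-+ c (f 0) _))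

sum-applyUpTo : ∀ (g : ℕ → ℚ) f m → sumℚ (map g (applyUpTo f m)) ≡ sumUpTo m (g ∘ f)
sum-applyUpTo g f zero    = refl
sum-applyUpTo g f (suc m) = cong (g (f 0) +_) (sum-applyUpTo g (f ∘ suc) m)

sum-range : ∀ (g : ℕ → ℚ) lo hi → sumℚ (map g (range lo hi)) ≡ sumUpTo (suc hi ∸ lo) (λ i → g (lo ℕ.+ i))
sum-range g lo hi = trans (sum-map g (lo ℕ.+_) (List.upTo (suc hi ∸ lo)))
                          (sum-applyUpTo (λ i → g (lo ℕ.+ i)) (λ i → i) (suc hi ∸ lo))

-- conv B h N = Σ_{t ≤ N} B^(N-t) h t, the convolution of h with the geometric sequence B^N.
conv : ℚ → (ℕ → ℚ) → ℕ → ℚ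
conv B h zero    = h 0
conv B h (suc N) = B * conv B h N + h (suc N)

conv-cong : ∀ B {h g} N → (∀ t → h t ≡ g t) → conv B h N ≡ conv B g N
conv-cong B zero    h≗g = h≗g 0
conv-cong B (suc N) h≗g = cong₂ (λ c v → B * c + v) (conv-cong B N h≗g) (h≗g (suc N))

conv-zero : ∀ B h N → (∀ t → t ≤ N → h t ≡ 0ℚ) → conv B h N ≡ 0ℚ
conv-zero B h zero    h≡0 = h≡0 0 z≤n
conv-zero B h (suc N) h≡0 = begin
  B * conv B h N + h (suc N)
    ≡⟨ cong₂ (λ c v → B * c + v) (conv-zero B h N (λ t t≤N → h≡0 t (ℕP.m≤n⇒m≤1+n t≤N))) (h≡0 (suc N) ℕP.≤-refl) ⟩
  B * 0ℚ + 0ℚ                 ≡⟨ cong (_+ 0ℚ) (ℚP.*-zeroʳ B) ⟩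
  0ℚ                          ∎

conv-+ : ∀ B h g N → conv B (λ t → h t + g t) N ≡ conv B h N + conv B g N
conv-+ B h g zero    = refl
conv-+ B h g (suc N) =
  trans (cong (λ c → B * c + (h (suc N) + g (suc N))) (conv-+ B h g N)) (regroup B _ _ (h (suc N)) (g (suc N)))
  where
  regroup : ∀ B a b c d → B * (a + b) + (c + d) ≡ (B * a + c) + (B * b + d)
  regroup = solve-∀ ℚ-ring

conv-*ˡ : ∀ B c h N → conv B (λ t → c * h t) N ≡ c * conv B h N
conv-*ˡ B c h zero    = refl
conv-*ˡ B c h (suc N) = trans (cong (λ v → B * v + c * h (suc N)) (conv-*ˡ B c h N)) (regroup B c _ (h (suc N)))
  where
  regroup : ∀ B c a d → B * (c * a) + c * d ≡ c * (B * a + d)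
  regroup = solve-∀ ℚ-ring

conv-*ʳ : ∀ B c h N → conv B (λ t → h t * c) N ≡ conv B h N * c
conv-*ʳ B c h N = begin
  conv B (λ t → h t * c) N  ≡⟨ conv-cong B N (λ t → ℚP.*-comm (h t) c) ⟩
  conv B (λ t → c * h t) N  ≡⟨ conv-*ˡ B c h N ⟩
  c * conv B h N            ≡⟨ ℚP.*-comm c _ ⟩
  conv B h N * c            ∎

conv-sum : ∀ {A : Set} B (g : A → ℕ → ℚ) xs N →
  conv B (λ t → sumℚ (map (λ a → g a t) xs)) N ≡ sumℚ (map (λ a → conv B (g a) N) xs)
conv-sum B g []       N = conv-zero B (λ _ → 0ℚ) N (λ _ _ → refl)
conv-sum B g (a ∷ xs) N =
  trans (conv-+ B (g a) (λ t → sumℚ (map (λ a′ → g a′ t) xs)) N) (cong (conv B (g a) N +_) (conv-sum B g xs N))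

conv-peel : ∀ B h N → conv B h (suc N) ≡ conv B (h ∘ suc) N + h 0 * B ^ℚ suc N
conv-peel B h zero    = regroup B (h 0) (h 1)
  where
  regroup : ∀ B h0 h1 → B * h0 + h1 ≡ h1 + h0 * (B * 1ℚ)
  regroup = solve-∀ ℚ-ring
conv-peel B h (suc N) =
  trans (cong (λ c → B * c + h (suc (suc N))) (conv-peel B h N)) (regroup B _ (h 0) (B ^ℚ suc N) (h (suc (suc N))))
  where
  regroup : ∀ B c h0 P h2 → B * (c + h0 * P) + h2 ≡ (B * c + h2) + h0 * (B * P)
  regroup = solve-∀ ℚ-ring

conv-shift : ∀ B k h N → (∀ s → s < k → h s ≡ 0ℚ) → conv B h (N ℕ.+ k) ≡ conv B (λ t → h (t ℕ.+ k)) N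
conv-shift B zero    h N _   =
  trans (cong (conv B h) (ℕP.+-identityʳ N)) (conv-cong B N (λ t → cong h (sym (ℕP.+-identityʳ t))))
conv-shift B (suc k) h N h≡0 = begin
  conv B h (N ℕ.+ suc k)                ≡⟨ cong (conv B h) (ℕP.+-suc N k) ⟩
  conv B h (suc (N ℕ.+ k))              ≡⟨ conv-peel B h (N ℕ.+ k) ⟩
  conv B (h ∘ suc) (N ℕ.+ k) + h 0 * P  ≡⟨ cong (λ v → conv B (h ∘ suc) (N ℕ.+ k) + v * P) h0≡0 ⟩
  conv B (h ∘ suc) (N ℕ.+ k) + 0ℚ * P   ≡⟨ drop-zero _ P ⟩
  conv B (h ∘ suc) (N ℕ.+ k)            ≡⟨ conv-shift B k (h ∘ suc) N (λ s s<k → h≡0 (suc s) (s≤s s<k)) ⟩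
  conv B (λ t → h (suc (t ℕ.+ k))) N    ≡⟨ conv-cong B N (λ t → cong h (sym (ℕP.+-suc t k))) ⟩
  conv B (λ t → h (t ℕ.+ suc k)) N      ∎
  where
  P = B ^ℚ suc (N ℕ.+ k)
  h0≡0 : h 0 ≡ 0ℚ
  h0≡0 = h≡0 0 (s≤s z≤n)
  drop-zero : ∀ a P → a + 0ℚ * P ≡ a
  drop-zero = solve-∀ ℚ-ring

conv-geometric : ∀ A f N → conv A (λ t → f t * A ^ℚ t) N ≡ conv 1ℚ f N * A ^ℚ N
conv-geometric A f zero    = refl
conv-geometric A f (suc N) = begin
  A * conv A (λ t → f t * A ^ℚ t) N + f (suc N) * A ^ℚ suc N
    ≡⟨ cong (λ c → A * c + f (suc N) * A ^ℚ suc N) (conv-geometric A f N) ⟩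
  A * (conv 1ℚ f N * A ^ℚ N) + f (suc N) * (A * A ^ℚ N)
    ≡⟨ regroup A (conv 1ℚ f N) (A ^ℚ N) (f (suc N)) ⟩
  (1ℚ * conv 1ℚ f N + f (suc N)) * (A * A ^ℚ N) ∎
  where
  regroup : ∀ A S P f → A * (S * P) + f * (A * P) ≡ (1ℚ * S + f) * (A * P)
  regroup = solve-∀ ℚ-ring

conv-by-parts : ∀ B C h h′ N → (∀ t → h (suc t) ≡ C * (h t + h′ t)) →
  (C - B) * conv B h N ≡ h (suc N) - C * conv B h′ N - h 0 * B ^ℚ suc N
conv-by-parts B C h h′ N step = begin
  (C - B) * S                            ≡⟨ expand C B S S′ Z ⟩
  (C * (S + S′) + Z) - C * S′ - Z - B * S  ≡⟨ cong (λ v → v - C * S′ - Z - B * S) (sym two-ways) ⟩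
  (B * S + H) - C * S′ - Z - B * S         ≡⟨ cancel B S H (C * S′) Z ⟩
  H - C * S′ - Z                           ∎
  where
  S  = conv B h N
  S′ = conv B h′ N
  H  = h (suc N)
  Z  = h 0 * B ^ℚ suc N
  -- conv B h (N+1) computed from the right (definition) and from the left (conv-peel).
  two-ways : B * S + H ≡ C * (S + S′) + Z
  two-ways = begin
    conv B h (suc N)                        ≡⟨ conv-peel B h N ⟩
    conv B (h ∘ suc) N + Z                  ≡⟨ cong (_+ Z) (conv-cong B N step) ⟩
    conv B (λ t → C * (h t + h′ t)) N + Z   ≡⟨ cong (_+ Z) (conv-*ˡ B C _ N) ⟩
    C * conv B (λ t → h t + h′ t) N + Z     ≡⟨ cong (λ v → C * v + Z) (conv-+ B h h′ N) ⟩
    C * (S + S′) + Z                        ∎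
  expand : ∀ C B S S′ Z → (C - B) * S ≡ (C * (S + S′) + Z) - C * S′ - Z - B * S
  expand = solve-∀ ℚ-ring
  cancel : ∀ B S H CS′ Z → (B * S + H) - CS′ - Z - B * S ≡ H - CS′ - Z
  cancel = solve-∀ ℚ-ring

conv-as-sum : ∀ B h N → sumUpTo (suc N) (λ i → B ^ℚ i * h (N ∸ i)) ≡ conv B h N
conv-as-sum B h zero    = regroup (h 0)
  where
  regroup : ∀ a → 1ℚ * a + 0ℚ ≡ a
  regroup = solve-∀ ℚ-ring
conv-as-sum B h (suc N) = begin
  1ℚ * h (suc N) + sumUpTo (suc N) (λ i → B * B ^ℚ i * h (N ∸ i))
    ≡⟨ cong (1ℚ * h (suc N) +_) (sumUpTo-cong (suc N) (λ i _ → ℚP.*-assoc B (B ^ℚ i) (h (N ∸ i)))) ⟩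
  1ℚ * h (suc N) + sumUpTo (suc N) (λ i → B * (B ^ℚ i * h (N ∸ i)))
    ≡⟨ cong (1ℚ * h (suc N) +_) (sumUpTo-*ˡ (suc N) B (λ i → B ^ℚ i * h (N ∸ i))) ⟩
  1ℚ * h (suc N) + B * sumUpTo (suc N) (λ i → B ^ℚ i * h (N ∸ i))
    ≡⟨ cong (λ v → 1ℚ * h (suc N) + B * v) (conv-as-sum B h N) ⟩
  1ℚ * h (suc N) + B * conv B h N
    ≡⟨ regroup (h (suc N)) (B * conv B h N) ⟩
  B * conv B h N + h (suc N) ∎
  where
  regroup : ∀ a b → 1ℚ * a + b ≡ b + a
  regroup = solve-∀ ℚ-ring

addPoly : List ℚ → List ℚ → List ℚ
addPoly []      G       = G
addPoly (c ∷ F) []      = c ∷ F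
addPoly (c ∷ F) (d ∷ G) = c + d ∷ addPoly F G

scalePoly : ℚ → List ℚ → List ℚ
scalePoly s = map (s *_)

mulLinear : ℚ → ℚPoly → ℚPoly
mulLinear c F = addPoly (scalePoly c F) (0ℚ ∷ F)

eval-addPoly : ∀ F G t → evalℚPoly (addPoly F G) t ≡ evalℚPoly F t + evalℚPoly G t
eval-addPoly []      G       t = sym (ℚP.+-identityˡ _)
eval-addPoly (c ∷ F) []      t = sym (ℚP.+-identityʳ _)
eval-addPoly (c ∷ F) (d ∷ G) t =
  trans (cong (λ v → c + d + t * v) (eval-addPoly F G t)) (regroup c d t (evalℚPoly F t) (evalℚPoly G t))
  where
  regroup : ∀ c d t a b → (c + d) + t * (a + b) ≡ (c + t * a) + (d + t * b)
  regroup = solve-∀ ℚ-ring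

eval-scalePoly : ∀ s F t → evalℚPoly (scalePoly s F) t ≡ s * evalℚPoly F t
eval-scalePoly s []      t = sym (ℚP.*-zeroʳ s)
eval-scalePoly s (c ∷ F) t = trans (cong (λ v → s * c + t * v) (eval-scalePoly s F t)) (regroup s c t (evalℚPoly F t))
  where
  regroup : ∀ s c t a → s * c + t * (s * a) ≡ s * (c + t * a)
  regroup = solve-∀ ℚ-ring

eval-mulLinear : ∀ c F t → evalℚPoly (mulLinear c F) t ≡ (t + c) * evalℚPoly F t
eval-mulLinear c F t = begin
  evalℚPoly (addPoly (scalePoly c F) (0ℚ ∷ F)) t  ≡⟨ eval-addPoly (scalePoly c F) (0ℚ ∷ F) t ⟩
  evalℚPoly (scalePoly c F) t + (0ℚ + t * e)      ≡⟨ cong (_+ (0ℚ + t * e)) (eval-scalePoly c F t) ⟩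
  c * e + (0ℚ + t * e)                            ≡⟨ regroup c t e ⟩
  (t + c) * e                                     ∎
  where
  e = evalℚPoly F t
  regroup : ∀ c t e → c * e + (0ℚ + t * e) ≡ (t + c) * e
  regroup = solve-∀ ℚ-ring

eval-shiftUp : ∀ e F t → evalℚPoly (replicate e 0ℚ ++ F) t ≡ t ^ℚ e * evalℚPoly F t
eval-shiftUp zero    F t = sym (ℚP.*-identityˡ _)
eval-shiftUp (suc e) F t = trans (cong (λ v → 0ℚ + t * v) (eval-shiftUp e F t)) (regroup t (t ^ℚ e) (evalℚPoly F t))
  where
  regroup : ∀ t q f → 0ℚ + t * (q * f) ≡ t * q * f
  regroup = solve-∀ ℚ-ring

binom : ℕ → ℕ → ℚ
binom zero    t       = 1ℚ
binom (suc j) zero    = 0ℚ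
binom (suc j) (suc t) = binom (suc j) t + binom j t

binom-absorb : ∀ j t → ι t * binom j t ≡ ι j * binom j t + ι (suc j) * binom (suc j) t
binom-absorb zero    zero    = refl
binom-absorb (suc j) zero    = vanish (ι (suc j)) (ι (suc (suc j)))
  where
  vanish : ∀ a b → 0ℚ * 0ℚ ≡ a * 0ℚ + b * 0ℚ
  vanish = solve-∀ ℚ-ring
binom-absorb zero    (suc t) = begin
  ι (suc t) * 1ℚ                  ≡⟨ cong (_* 1ℚ) (ι-suc t) ⟩
  (ι t + 1ℚ) * 1ℚ                 ≡⟨ cong (λ v → (v + 1ℚ) * 1ℚ) ι-t ⟩
  (0ℚ * 1ℚ + 1ℚ * B₁ + 1ℚ) * 1ℚ    ≡⟨ regroup B₁ ⟩
  0ℚ * 1ℚ + 1ℚ * (B₁ + 1ℚ)         ∎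
  where
  B₁ = binom 1 t
  ι-t : ι t ≡ 0ℚ * 1ℚ + 1ℚ * B₁
  ι-t = trans (sym (ℚP.*-identityʳ (ι t))) (binom-absorb zero t)
  regroup : ∀ b → (0ℚ * 1ℚ + 1ℚ * b + 1ℚ) * 1ℚ ≡ 0ℚ * 1ℚ + 1ℚ * (b + 1ℚ)
  regroup = solve-∀ ℚ-ring
binom-absorb (suc j) (suc t) = begin
  ι (suc t) * (B₁ + B₀)
    ≡⟨ cong (_* (B₁ + B₀)) (ι-suc t) ⟩
  (ι t + 1ℚ) * (B₁ + B₀)
    ≡⟨ distribute (ι t) B₁ B₀ ⟩
  ι t * B₁ + ι t * B₀ + (B₁ + B₀)
    ≡⟨ cong₂ (λ u v → u + v + (B₁ + B₀)) (binom-absorb (suc j) t) (binom-absorb j t) ⟩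
  (a₁ * B₁ + a₂ * B₂) + (a₀ * B₀ + a₁ * B₁) + (B₁ + B₀)
    ≡⟨ cong₂ (λ u v → (u * B₁ + v * B₂) + (a₀ * B₀ + u * B₁) + (B₁ + B₀)) (ι-suc j) a₂≡ ⟩
  ((a₀ + 1ℚ) * B₁ + (a₀ + 1ℚ + 1ℚ) * B₂) + (a₀ * B₀ + (a₀ + 1ℚ) * B₁) + (B₁ + B₀)
    ≡⟨ regroup a₀ B₀ B₁ B₂ ⟩
  (a₀ + 1ℚ) * (B₁ + B₀) + (a₀ + 1ℚ + 1ℚ) * (B₂ + B₁)
    ≡⟨ sym (cong₂ (λ u v → u * (B₁ + B₀) + v * (B₂ + B₁)) (ι-suc j) a₂≡) ⟩
  a₁ * (B₁ + B₀) + a₂ * (B₂ + B₁) ∎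
  where
  B₀ = binom j t
  B₁ = binom (suc j) t
  B₂ = binom (suc (suc j)) t
  a₀ = ι j
  a₁ = ι (suc j)
  a₂ = ι (suc (suc j))
  a₂≡ : a₂ ≡ a₀ + 1ℚ + 1ℚ
  a₂≡ = trans (ι-suc (suc j)) (cong (_+ 1ℚ) (ι-suc j))
  distribute : ∀ a b c → (a + 1ℚ) * (b + c) ≡ a * b + a * c + (b + c)
  distribute = solve-∀ ℚ-ring
  regroup : ∀ a B₀ B₁ B₂ → ((a + 1ℚ) * B₁ + (a + 1ℚ + 1ℚ) * B₂) + (a * B₀ + (a + 1ℚ) * B₁) + (B₁ + B₀)
                          ≡ (a + 1ℚ) * (B₁ + B₀) + (a + 1ℚ + 1ℚ) * (B₂ + B₁)
  regroup = solve-∀ ℚ-ring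

evalBinFrom : ℕ → List ℚ → ℕ → ℚ
evalBinFrom m []      t = 0ℚ
evalBinFrom m (c ∷ F) t = c * binom m t + evalBinFrom (suc m) F t

evalBin : List ℚ → ℕ → ℚ
evalBin = evalBinFrom 0

evalBinFrom-addPoly : ∀ m F G t → evalBinFrom m (addPoly F G) t ≡ evalBinFrom m F t + evalBinFrom m G t
evalBinFrom-addPoly m []      G       t = sym (ℚP.+-identityˡ _)
evalBinFrom-addPoly m (c ∷ F) []      t = sym (ℚP.+-identityʳ _)
evalBinFrom-addPoly m (c ∷ F) (d ∷ G) t =
  trans (cong ((c + d) * binom m t +_) (evalBinFrom-addPoly (suc m) F G t))
        (regroup c d (binom m t) (evalBinFrom (suc m) F t) (evalBinFrom (suc m) G t))
  where
  regroup : ∀ c d b e f → (c + d) * b + (e + f) ≡ (c * b + e) + (d * b + f)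
  regroup = solve-∀ ℚ-ring

evalBinFrom-scalePoly : ∀ m s F t → evalBinFrom m (scalePoly s F) t ≡ s * evalBinFrom m F t
evalBinFrom-scalePoly m s []      t = sym (ℚP.*-zeroʳ s)
evalBinFrom-scalePoly m s (c ∷ F) t =
  trans (cong (s * c * binom m t +_) (evalBinFrom-scalePoly (suc m) s F t))
        (regroup s c (binom m t) (evalBinFrom (suc m) F t))
  where
  regroup : ∀ s c b e → s * c * b + s * e ≡ s * (c * b + e)
  regroup = solve-∀ ℚ-ring

evalBinFrom-suc : ∀ m F t → evalBinFrom (suc m) F (suc t) ≡ evalBinFrom (suc m) F t + evalBinFrom m F t
evalBinFrom-suc m []      t = sym (ℚP.+-identityʳ 0ℚ)
evalBinFrom-suc m (c ∷ F) t =
  trans (cong (c * (binom (suc m) t + binom m t) +_) (evalBinFrom-suc (suc m) F t))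
        (regroup c (binom (suc m) t) (binom m t) (evalBinFrom (suc (suc m)) F t) (evalBinFrom (suc m) F t))
  where
  regroup : ∀ c b₁ b₀ e₁ e₀ → c * (b₁ + b₀) + (e₁ + e₀) ≡ (c * b₁ + e₁) + (c * b₀ + e₀)
  regroup = solve-∀ ℚ-ring

evalBin-suc : ∀ c F t → evalBin (c ∷ F) (suc t) ≡ evalBin (c ∷ F) t + evalBin F t
evalBin-suc c F t = trans (cong (c * 1ℚ +_) (evalBinFrom-suc 0 F t)) (sym (ℚP.+-assoc (c * 1ℚ) _ _))

evalBinFrom-zero : ∀ m F → evalBinFrom (suc m) F 0 ≡ 0ℚ
evalBinFrom-zero m []      = refl
evalBinFrom-zero m (c ∷ F) = trans (cong (c * 0ℚ +_) (evalBinFrom-zero (suc m) F)) (vanish c)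
  where
  vanish : ∀ c → c * 0ℚ + 0ℚ ≡ 0ℚ
  vanish = solve-∀ ℚ-ring

evalBin-zero : ∀ c F → evalBin (c ∷ F) 0 ≡ c
evalBin-zero c F = trans (cong (c * 1ℚ +_) (evalBinFrom-zero 0 F)) (simplify c)
  where
  simplify : ∀ c → c * 1ℚ + 0ℚ ≡ c
  simplify = solve-∀ ℚ-ring

conv-binom : ∀ m N → conv 1ℚ (binom m) N ≡ binom (suc m) (suc N)
conv-binom m zero    = sym (ℚP.+-identityˡ (binom m 0))
conv-binom m (suc N) = cong (_+ binom m (suc N)) (trans (ℚP.*-identityˡ _) (conv-binom m N))

conv-evalBinFrom : ∀ m F N → conv 1ℚ (evalBinFrom m F) N ≡ evalBinFrom (suc m) F (suc N)
conv-evalBinFrom m []      N = conv-zero 1ℚ (λ _ → 0ℚ) N (λ _ _ → refl)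
conv-evalBinFrom m (c ∷ F) N = begin
  conv 1ℚ (λ t → c * binom m t + evalBinFrom (suc m) F t) N
    ≡⟨ conv-+ 1ℚ (λ t → c * binom m t) (evalBinFrom (suc m) F) N ⟩
  conv 1ℚ (λ t → c * binom m t) N + conv 1ℚ (evalBinFrom (suc m) F) N
    ≡⟨ cong₂ _+_ (conv-*ˡ 1ℚ c (binom m) N) (conv-evalBinFrom (suc m) F N) ⟩
  c * conv 1ℚ (binom m) N + evalBinFrom (suc (suc m)) F (suc N)
    ≡⟨ cong (λ v → c * v + evalBinFrom (suc (suc m)) F (suc N)) (conv-binom m N) ⟩
  c * binom (suc m) (suc N) + evalBinFrom (suc (suc m)) F (suc N) ∎

cumulative : List ℚ → List ℚ
cumulative F = addPoly (0ℚ ∷ F) F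

evalBin-cumulative : ∀ F N → evalBin (cumulative F) N ≡ conv 1ℚ (evalBin F) N
evalBin-cumulative F N = begin
  evalBin (addPoly (0ℚ ∷ F) F) N                       ≡⟨ evalBinFrom-addPoly 0 (0ℚ ∷ F) F N ⟩
  (0ℚ * 1ℚ + evalBinFrom 1 F N) + evalBin F N          ≡⟨ cong (_+ evalBin F N) (drop-zero (evalBinFrom 1 F N)) ⟩
  evalBinFrom 1 F N + evalBin F N                      ≡⟨ sym (evalBinFrom-suc 0 F N) ⟩
  evalBinFrom 1 F (suc N)                              ≡⟨ sym (conv-evalBinFrom 0 F N) ⟩
  conv 1ℚ (evalBin F) N                                ∎
  where
  drop-zero : ∀ a → 0ℚ * 1ℚ + a ≡ a
  drop-zero = solve-∀ ℚ-ring

-- Multiplication by t in the binomial basis starting at (t choose m), via binom-absorb.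
timesN : ℕ → List ℚ → List ℚ
timesN m []      = []
timesN m (c ∷ F) = c * ι m ∷ addPoly [ c * ι (suc m) ] (timesN (suc m) F)

evalBinFrom-timesN : ∀ m F t → evalBinFrom m (timesN m F) t ≡ ι t * evalBinFrom m F t
evalBinFrom-timesN m []      t = sym (ℚP.*-zeroʳ (ι t))
evalBinFrom-timesN m (c ∷ F) t = begin
  c * ι m * b₀ + evalBinFrom (suc m) (addPoly [ c * ι (suc m) ] (timesN (suc m) F)) t
    ≡⟨ cong (c * ι m * b₀ +_) (evalBinFrom-addPoly (suc m) [ c * ι (suc m) ] (timesN (suc m) F) t) ⟩
  c * ι m * b₀ + ((c * ι (suc m) * b₁ + 0ℚ) + evalBinFrom (suc m) (timesN (suc m) F) t)
    ≡⟨ cong (λ v → c * ι m * b₀ + ((c * ι (suc m) * b₁ + 0ℚ) + v)) (evalBinFrom-timesN (suc m) F t) ⟩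
  c * ι m * b₀ + ((c * ι (suc m) * b₁ + 0ℚ) + ι t * e)
    ≡⟨ regroup c (ι m) (ι (suc m)) b₀ b₁ (ι t) e ⟩
  c * (ι m * b₀ + ι (suc m) * b₁) + ι t * e
    ≡⟨ cong (λ v → c * v + ι t * e) (sym (binom-absorb m t)) ⟩
  c * (ι t * b₀) + ι t * e
    ≡⟨ factor c (ι t) b₀ e ⟩
  ι t * (c * b₀ + e) ∎
  where
  b₀ = binom m t
  b₁ = binom (suc m) t
  e  = evalBinFrom (suc m) F t
  regroup : ∀ c a a′ b₀ b₁ t e → c * a * b₀ + ((c * a′ * b₁ + 0ℚ) + t * e) ≡ c * (a * b₀ + a′ * b₁) + t * e
  regroup = solve-∀ ℚ-ring
  factor : ∀ c t b e → c * (t * b) + t * e ≡ t * (c * b + e)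
  factor = solve-∀ ℚ-ring

mulShift : ℚ → List ℚ → List ℚ
mulShift s F = addPoly (timesN 0 F) (scalePoly s F)

evalBin-mulShift : ∀ s F t → evalBin (mulShift s F) t ≡ (ι t + s) * evalBin F t
evalBin-mulShift s F t = begin
  evalBin (addPoly (timesN 0 F) (scalePoly s F)) t   ≡⟨ evalBinFrom-addPoly 0 (timesN 0 F) (scalePoly s F) t ⟩
  evalBin (timesN 0 F) t + evalBin (scalePoly s F) t
    ≡⟨ cong₂ _+_ (evalBinFrom-timesN 0 F t) (evalBinFrom-scalePoly 0 s F t) ⟩
  ι t * evalBin F t + s * evalBin F t                ≡⟨ sym (ℚP.*-distribʳ-+ (evalBin F t) (ι t) s) ⟩
  (ι t + s) * evalBin F t                            ∎

-- The polynomial n ↦ ((n - k) choose j) in the monomial basis, built from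
-- (j+1) (t choose j+1) = (t - j) (t choose j).
binomPoly : ℕ → ℕ → ℚPoly
binomPoly k zero    = [ 1ℚ ]
binomPoly k (suc j) = scalePoly (recip (ι (suc j)) (ι-suc≢0 j)) (mulLinear (- (ι k + ι j)) (binomPoly k j))

eval-binomPoly : ∀ k j t → evalℚPoly (binomPoly k j) (ι (t ℕ.+ k)) ≡ binom j t
eval-binomPoly k zero    t = simplify (ι (t ℕ.+ k))
  where
  simplify : ∀ y → 1ℚ + y * 0ℚ ≡ 1ℚ
  simplify = solve-∀ ℚ-ring
eval-binomPoly k (suc j) t = begin
  evalℚPoly (scalePoly ν (mulLinear (- (ι k + ι j)) (binomPoly k j))) (ι (t ℕ.+ k))
    ≡⟨ eval-scalePoly ν (mulLinear (- (ι k + ι j)) (binomPoly k j)) (ι (t ℕ.+ k)) ⟩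
  ν * evalℚPoly (mulLinear (- (ι k + ι j)) (binomPoly k j)) (ι (t ℕ.+ k))
    ≡⟨ cong (ν *_) (eval-mulLinear (- (ι k + ι j)) (binomPoly k j) (ι (t ℕ.+ k))) ⟩
  ν * ((ι (t ℕ.+ k) + - (ι k + ι j)) * evalℚPoly (binomPoly k j) (ι (t ℕ.+ k)))
    ≡⟨ cong₂ (λ u v → ν * ((u + - (ι k + ι j)) * v)) (ι-+ t k) (eval-binomPoly k j t) ⟩
  ν * ((ι t + ι k + - (ι k + ι j)) * binom j t)
    ≡⟨ cong (ν *_) (regroup (ι t) (ι k) (ι j) (binom j t)) ⟩
  ν * (ι t * binom j t - ι j * binom j t)
    ≡⟨ cong (λ v → ν * (v - ι j * binom j t)) (binom-absorb j t) ⟩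
  ν * ((ι j * binom j t + ι (suc j) * binom (suc j) t) - ι j * binom j t)
    ≡⟨ cong (ν *_) (cancel (ι j * binom j t) (ι (suc j) * binom (suc j) t)) ⟩
  ν * (ι (suc j) * binom (suc j) t)
    ≡⟨ recip-cancel (ι (suc j)) (ι-suc≢0 j) (binom (suc j) t) ⟩
  binom (suc j) t ∎
  where
  ν = recip (ι (suc j)) (ι-suc≢0 j)
  regroup : ∀ t k j b → (t + k + - (k + j)) * b ≡ t * b - j * b
  regroup = solve-∀ ℚ-ring
  cancel : ∀ a b → (a + b) - a ≡ b
  cancel = solve-∀ ℚ-ring

-- Conversion from the binomial basis in N to the monomial basis in n = N + k.
toMonomialFrom : ℕ → ℕ → List ℚ → ℚPoly
toMonomialFrom k m []      = []
toMonomialFrom k m (c ∷ F) = addPoly (scalePoly c (binomPoly k m)) (toMonomialFrom k (suc m) F)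

eval-toMonomialFrom : ∀ k m F t → evalℚPoly (toMonomialFrom k m F) (ι (t ℕ.+ k)) ≡ evalBinFrom m F t
eval-toMonomialFrom k m []      t = refl
eval-toMonomialFrom k m (c ∷ F) t =
  trans (eval-addPoly (scalePoly c (binomPoly k m)) (toMonomialFrom k (suc m) F) (ι (t ℕ.+ k)))
        (cong₂ _+_ (trans (eval-scalePoly c (binomPoly k m) (ι (t ℕ.+ k))) (cong (c *_) (eval-binomPoly k m t)))
                   (eval-toMonomialFrom k (suc m) F t))

-- f lies in the span of the basis functions ⟦ t ⟧ (t : T): it is the sum of
-- ⟦ t ⟧ over an explicit finite list of terms (scalars are absorbed into terms).
record InSpan {T D : Set} (⟦_⟧ : T → D → ℚ) (f : D → ℚ) : Set where
  constructor spanned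
  field
    terms      : List T
    represents : ∀ d → f d ≡ sumℚ (map (λ t → ⟦ t ⟧ d) terms)

module _ {T D : Set} {⟦_⟧ : T → D → ℚ} where

  span-cong : ∀ {f g} → (∀ d → f d ≡ g d) → InSpan ⟦_⟧ f → InSpan ⟦_⟧ g
  span-cong f≗g (spanned ts rep) = spanned ts (λ d → trans (sym (f≗g d)) (rep d))

  span-term : ∀ t → InSpan ⟦_⟧ ⟦ t ⟧
  span-term t = spanned [ t ] (λ d → sym (ℚP.+-identityʳ (⟦ t ⟧ d)))

  span-+ : ∀ {f g} → InSpan ⟦_⟧ f → InSpan ⟦_⟧ g → InSpan ⟦_⟧ (λ d → f d + g d)
  span-+ (spanned ts rep) (spanned us rep′) =
    spanned (ts ++ us) (λ d → trans (cong₂ _+_ (rep d) (rep′ d)) (sym (sum-++ (λ t → ⟦ t ⟧ d) ts us)))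

  span-sum : ∀ {A : Set} (xs : List A) {f : A → D → ℚ} →
    (∀ a → InSpan ⟦_⟧ (f a)) → InSpan ⟦_⟧ (λ d → sumℚ (map (λ a → f a d) xs))
  span-sum []       p = spanned [] (λ d → refl)
  span-sum (a ∷ xs) p = span-+ (p a) (span-sum xs p)

span-map : ∀ {T T′ D D′ : Set} {⟦_⟧ : T → D → ℚ} {⟦_⟧′ : T′ → D′ → ℚ} {f : D → ℚ}
  (τ : T → T′) (π : D′ → D) (φ : D′ → ℚ) → (∀ t d → ⟦ τ t ⟧′ d ≡ φ d * ⟦ t ⟧ (π d)) →
  InSpan ⟦_⟧ f → InSpan ⟦_⟧′ (λ d → φ d * f (π d))
span-map {⟦_⟧ = ⟦_⟧} {⟦_⟧′} {f} τ π φ τ-eq (spanned ts rep) = spanned (map τ ts) λ d → begin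
  φ d * f (π d)                                ≡⟨ cong (φ d *_) (rep (π d)) ⟩
  φ d * sumℚ (map (λ t → ⟦ t ⟧ (π d)) ts)      ≡⟨ sym (sum-*ˡ (φ d) (λ t → ⟦ t ⟧ (π d)) ts) ⟩
  sumℚ (map (λ t → φ d * ⟦ t ⟧ (π d)) ts)      ≡⟨ sum-cong (λ t → sym (τ-eq t d)) ts ⟩
  sumℚ (map (λ t → ⟦ τ t ⟧′ d) ts)             ≡⟨ sym (sum-map (λ t′ → ⟦ t′ ⟧′ d) τ ts) ⟩
  sumℚ (map (λ t′ → ⟦ t′ ⟧′ d) (map τ ts))     ∎

-- An exponential-polynomial term (F , G , i) is (x , N) ↦ F(N) G(x) (x + r i)^N,
-- with F in the binomial basis and G in the monomial basis.
ExpTerm : ℕ → Set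
ExpTerm K = List ℚ × ℚPoly × Fin K

expTerm : ∀ {K} → (Fin K → ℚ) → ExpTerm K → ℚ × ℕ → ℚ
expTerm r (F , G , i) (x , N) = evalBin F N * evalℚPoly G x * (x + r i) ^ℚ N

ExpPoly : ∀ {K} → (Fin K → ℚ) → (ℚ × ℕ → ℚ) → Set
ExpPoly r = InSpan (expTerm r)

expPoly-lift : ∀ {K} (r : Fin (suc K) → ℚ) {f} → ExpPoly (r ∘ suc) f → ExpPoly r f
expPoly-lift r p = span-cong (λ d → ℚP.*-identityˡ _)
  (span-map (λ { (F , G , i) → (F , G , suc i) }) (λ d → d) (λ _ → 1ℚ)
            (λ { (F , G , i) d → sym (ℚP.*-identityˡ _) }) p)

module _ {K : ℕ} (r : Fin K → ℚ) where

  private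
    factor-middle : ∀ e c g P → e * (c * g) * P ≡ c * (e * g * P)
    factor-middle = solve-∀ ℚ-ring

  expPoly-scale : ∀ c {f} → ExpPoly r f → ExpPoly r (λ d → c * f d)
  expPoly-scale c = span-map scaleTerm (λ d → d) (λ _ → c) scaleTerm-eq
    where
    scaleTerm : ExpTerm K → ExpTerm K
    scaleTerm (F , G , i) = (F , scalePoly c G , i)
    scaleTerm-eq : ∀ τ d → expTerm r (scaleTerm τ) d ≡ c * expTerm r τ d
    scaleTerm-eq (F , G , i) (x , N) =
      trans (cong (λ g → evalBin F N * g * (x + r i) ^ℚ N) (eval-scalePoly c G x))
            (factor-middle (evalBin F N) c (evalℚPoly G x) ((x + r i) ^ℚ N))

  expPoly-mulX : ∀ c {f} → ExpPoly r f → ExpPoly r (λ (x , N) → (x + c) * f (x , N))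
  expPoly-mulX c = span-map mulXTerm (λ d → d) (λ (x , _) → x + c) mulXTerm-eq
    where
    mulXTerm : ExpTerm K → ExpTerm K
    mulXTerm (F , G , i) = (F , mulLinear c G , i)
    mulXTerm-eq : ∀ τ d → expTerm r (mulXTerm τ) d ≡ (proj₁ d + c) * expTerm r τ d
    mulXTerm-eq (F , G , i) (x , N) =
      trans (cong (λ g → evalBin F N * g * (x + r i) ^ℚ N) (eval-mulLinear c G x))
            (factor-middle (evalBin F N) (x + c) (evalℚPoly G x) ((x + r i) ^ℚ N))

  expPoly-mulN : ∀ s {f} → ExpPoly r f → ExpPoly r (λ (x , N) → (ι N + s) * f (x , N))
  expPoly-mulN s = span-map mulNTerm (λ d → d) (λ (_ , N) → ι N + s) mulNTerm-eq
    where
    mulNTerm : ExpTerm K → ExpTerm K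
    mulNTerm (F , G , i) = (mulShift s F , G , i)
    mulNTerm-eq : ∀ τ d → expTerm r (mulNTerm τ) d ≡ (ι (proj₂ d) + s) * expTerm r τ d
    mulNTerm-eq (F , G , i) (x , N) =
      trans (cong (λ e → e * evalℚPoly G x * (x + r i) ^ℚ N) (evalBin-mulShift s F N))
            (reassoc (ι N + s) (evalBin F N) (evalℚPoly G x) ((x + r i) ^ℚ N))
      where
      reassoc : ∀ a e g P → a * e * g * P ≡ a * (e * g * P)
      reassoc = solve-∀ ℚ-ring

  expPoly-mulNpow : ∀ s e {f} → ExpPoly r f → ExpPoly r (λ (x , N) → (ι N + s) ^ℚ e * f (x , N))
  expPoly-mulNpow s zero    {f} p = span-cong (λ d → sym (ℚP.*-identityˡ (f d))) p
  expPoly-mulNpow s (suc e) {f} p =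
    span-cong (λ (x , N) → sym (ℚP.*-assoc (ι N + s) ((ι N + s) ^ℚ e) (f (x , N))))
              (expPoly-mulN s (expPoly-mulNpow s e p))

  expPoly-− : ∀ {f g} → ExpPoly r f → ExpPoly r g → ExpPoly r (λ d → f d - g d)
  expPoly-− {f} {g} p q = span-cong (λ d → minus (f d) (g d)) (span-+ p (expPoly-scale (- 1ℚ) q))
    where
    minus : ∀ a b → a + - 1ℚ * b ≡ a - b
    minus = solve-∀ ℚ-ring

  convWith : Fin K → (ℚ × ℕ → ℚ) → ℚ × ℕ → ℚ
  convWith j f (x , N) = conv (x + r j) (λ t → f (x , t)) N

  -- Equal bases: the convolution is a discrete integral of F.
  conv-term-equal : ∀ {i j} → r i ≡ r j → ∀ F G → ExpPoly r (convWith j (expTerm r (F , G , i)))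
  conv-term-equal {i} {j} ri≡rj F G = span-cong integrated (span-term (cumulative F , G , i))
    where
    integrated : ∀ d → expTerm r (cumulative F , G , i) d ≡ convWith j (expTerm r (F , G , i)) d
    integrated (x , N) = sym (begin
      conv (x + r j) (λ t → evalBin F t * g * A ^ℚ t) N
        ≡⟨ cong (λ a → conv (x + a) (λ t → evalBin F t * g * A ^ℚ t) N) (sym ri≡rj) ⟩
      conv A (λ t → evalBin F t * g * A ^ℚ t) N
        ≡⟨ conv-geometric A (λ t → evalBin F t * g) N ⟩
      conv 1ℚ (λ t → evalBin F t * g) N * A ^ℚ N
        ≡⟨ cong (_* A ^ℚ N) (conv-*ʳ 1ℚ g (evalBin F) N) ⟩
      conv 1ℚ (evalBin F) N * g * A ^ℚ N
        ≡⟨ cong (λ v → v * g * A ^ℚ N) (sym (evalBin-cumulative F N)) ⟩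
      evalBin (cumulative F) N * g * A ^ℚ N ∎)
      where
      A = x + r i
      g = evalℚPoly G x

  -- Distinct bases: summation by parts expresses the convolution for c ∷ F through
  -- the one for the shorter F, after dividing by r i - r j.
  conv-term-distinct : ∀ {i j} → r i ≢ r j → ∀ F G → ExpPoly r (convWith j (expTerm r (F , G , i)))
  conv-term-distinct {i} {j} ri≢rj [] G = span-cong vanishes (spanned [] (λ _ → refl))
    where
    vanishes : ∀ d → 0ℚ ≡ convWith j (expTerm r ([] , G , i)) d
    vanishes (x , N) = sym (conv-zero (x + r j) _ N (λ t _ → zero-lead (evalℚPoly G x) ((x + r i) ^ℚ t)))
      where
      zero-lead : ∀ g P → 0ℚ * g * P ≡ 0ℚ
      zero-lead = solve-∀ ℚ-ring
  conv-term-distinct {i} {j} ri≢rj (c ∷ F) G =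
    span-cong (λ d → sym (by-parts d))
      (expPoly-scale δ (expPoly-− (expPoly-− (span-term τ₁) (expPoly-mulX (r i) (conv-term-distinct ri≢rj F G)))
                                  (span-term τ₂)))
    where
    ri-rj≢0 : r i - r j ≢ 0ℚ
    ri-rj≢0 eq = ri≢rj (begin
      r i                  ≡⟨ split (r i) (r j) ⟩
      (r i - r j) + r j    ≡⟨ cong (_+ r j) eq ⟩
      0ℚ + r j             ≡⟨ ℚP.+-identityˡ (r j) ⟩
      r j                  ∎)
      where
      split : ∀ a b → a ≡ (a - b) + b
      split = solve-∀ ℚ-ring
    δ  = recip (r i - r j) ri-rj≢0
    -- h(N+1) and h(0) (x + r j)^(N+1), for h = expTerm r (c ∷ F , G , i), as terms.
    τ₁ = (addPoly (c ∷ F) F , mulLinear (r i) G , i)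
    τ₂ = ([ c ] , mulLinear (r j) G , j)
    by-parts : ∀ d → convWith j (expTerm r (c ∷ F , G , i)) d
                   ≡ δ * (expTerm r τ₁ d - (proj₁ d + r i) * convWith j (expTerm r (F , G , i)) d - expTerm r τ₂ d)
    by-parts (x , N) = begin
      S                                            ≡⟨ sym (recip-cancel (r i - r j) ri-rj≢0 S) ⟩
      δ * ((r i - r j) * S)                        ≡⟨ cong (λ v → δ * (v * S)) (sym (bases-differ x (r i) (r j))) ⟩
      δ * ((Aᵢ - Aⱼ) * S)                          ≡⟨ cong (δ *_) (conv-by-parts Aⱼ Aᵢ h h′ N step) ⟩
      δ * (h (suc N) - Aᵢ * S′ - h 0 * Aⱼ ^ℚ suc N)
        ≡⟨ cong₂ (λ u v → δ * (u - Aᵢ * S′ - v)) last-term first-term ⟩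
      δ * (expTerm r τ₁ (x , N) - Aᵢ * S′ - expTerm r τ₂ (x , N)) ∎
      where
      Aᵢ = x + r i
      Aⱼ = x + r j
      g  = evalℚPoly G x
      h  = λ t → expTerm r (c ∷ F , G , i) (x , t)
      h′ = λ t → expTerm r (F , G , i) (x , t)
      S  = conv Aⱼ h N
      S′ = conv Aⱼ h′ N
      bases-differ : ∀ x a b → (x + a) - (x + b) ≡ a - b
      bases-differ = solve-∀ ℚ-ring
      step : ∀ t → h (suc t) ≡ Aᵢ * (h t + h′ t)
      step t = trans (cong (λ e → e * g * (Aᵢ * Aᵢ ^ℚ t)) (evalBin-suc c F t))
                     (regroup (evalBin (c ∷ F) t) (evalBin F t) g Aᵢ (Aᵢ ^ℚ t))
        where
        regroup : ∀ e₀ e₁ g A P → (e₀ + e₁) * g * (A * P) ≡ A * (e₀ * g * P + e₁ * g * P)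
        regroup = solve-∀ ℚ-ring
      last-term : h (suc N) ≡ expTerm r τ₁ (x , N)
      last-term = begin
        evalBin (c ∷ F) (suc N) * g * (Aᵢ * Aᵢ ^ℚ N)
          ≡⟨ cong (λ e → e * g * (Aᵢ * Aᵢ ^ℚ N)) (evalBin-suc c F N) ⟩
        (evalBin (c ∷ F) N + evalBin F N) * g * (Aᵢ * Aᵢ ^ℚ N)
          ≡⟨ regroup (evalBin (c ∷ F) N + evalBin F N) g Aᵢ (Aᵢ ^ℚ N) ⟩
        (evalBin (c ∷ F) N + evalBin F N) * (Aᵢ * g) * Aᵢ ^ℚ N
          ≡⟨ sym (cong₂ (λ u v → u * v * Aᵢ ^ℚ N)
                        (evalBinFrom-addPoly 0 (c ∷ F) F N) (eval-mulLinear (r i) G x)) ⟩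
        expTerm r τ₁ (x , N) ∎
        where
        regroup : ∀ e g A P → e * g * (A * P) ≡ e * (A * g) * P
        regroup = solve-∀ ℚ-ring
      first-term : h 0 * Aⱼ ^ℚ suc N ≡ expTerm r τ₂ (x , N)
      first-term = begin
        evalBin (c ∷ F) 0 * g * 1ℚ * (Aⱼ * Aⱼ ^ℚ N)
          ≡⟨ cong (λ e → e * g * 1ℚ * (Aⱼ * Aⱼ ^ℚ N)) (evalBin-zero c F) ⟩
        c * g * 1ℚ * (Aⱼ * Aⱼ ^ℚ N)
          ≡⟨ regroup c g Aⱼ (Aⱼ ^ℚ N) ⟩
        (c * 1ℚ + 0ℚ) * (Aⱼ * g) * Aⱼ ^ℚ N
          ≡⟨ sym (cong (λ v → (c * 1ℚ + 0ℚ) * v * Aⱼ ^ℚ N) (eval-mulLinear (r j) G x)) ⟩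
        expTerm r τ₂ (x , N) ∎
        where
        regroup : ∀ c g A P → c * g * 1ℚ * (A * P) ≡ (c * 1ℚ + 0ℚ) * (A * g) * P
        regroup = solve-∀ ℚ-ring

  conv-term : ∀ τ j → ExpPoly r (convWith j (expTerm r τ))
  conv-term (F , G , i) j with r i ℚP.≟ r j
  ... | yes ri≡rj = conv-term-equal ri≡rj F G
  ... | no  ri≢rj = conv-term-distinct ri≢rj F G

  expPoly-conv : ∀ j {f} → ExpPoly r f → ExpPoly r (convWith j f)
  expPoly-conv j {f} (spanned ts rep) = span-cong linear (span-sum ts (λ τ → conv-term τ j))
    where
    linear : ∀ d → sumℚ (map (λ τ → convWith j (expTerm r τ) d) ts) ≡ convWith j f d
    linear (x , N) = sym (trans (conv-cong (x + r j) N (λ t → rep (x , t)))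
                                (conv-sum (x + r j) (λ τ t → expTerm r τ (x , t)) ts N))

-- The iterated convolution that the inner sums of M reduce to:
-- W 0 R = (x + r 0)^R and W (k+1) (R+1) = Σ_{s ≤ R} (x + r 0)^(R-s) (s+1)^e W k s.
W : ∀ k → Vec ℕ k → (Fin (suc k) → ℚ) → ℚ → ℕ → ℚ
W zero    []       r x R       = (x + r zero) ^ℚ R
W (suc k) (e ∷ es) r x zero    = 0ℚ
W (suc k) (e ∷ es) r x (suc R) = conv (x + r zero) (λ s → ι (suc s) ^ℚ e * W k es (r ∘ suc) x s) R

-- W k R vanishes for R < k (there is no room for k increasing indices).
W-vanishes : ∀ k es r x s → s < k → W k es r x s ≡ 0ℚ
W-vanishes (suc k) (e ∷ es) r x zero    _         = refl
W-vanishes (suc k) (e ∷ es) r x (suc s) (s≤s s<k) = conv-zero (x + r zero) _ s vanish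
  where
  vanish : ∀ t → t ≤ s → ι (suc t) ^ℚ e * W k es (r ∘ suc) x t ≡ 0ℚ
  vanish t t≤s = trans (cong (ι (suc t) ^ℚ e *_) (W-vanishes k es (r ∘ suc) x t (ℕP.≤-<-trans t≤s s<k)))
                       (ℚP.*-zeroʳ (ι (suc t) ^ℚ e))

W-step : ∀ k e es r x N → W (suc k) (e ∷ es) r x (N ℕ.+ suc k)
  ≡ convWith r zero (λ (x , t) → (ι t + ι (suc k)) ^ℚ e * W k es (r ∘ suc) x (t ℕ.+ k)) (x , N)
W-step k e es r x N = begin
  W (suc k) (e ∷ es) r x (N ℕ.+ suc k)  ≡⟨ cong (W (suc k) (e ∷ es) r x) (ℕP.+-suc N k) ⟩
  conv A h (N ℕ.+ k)                     ≡⟨ conv-shift A k h N (λ s s<k → h-vanishes s s<k) ⟩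
  conv A (λ t → h (t ℕ.+ k)) N           ≡⟨ conv-cong A N (λ t → cong (λ v → v ^ℚ e * W′ (t ℕ.+ k)) (ι-shift t)) ⟩
  conv A (λ t → (ι t + ι (suc k)) ^ℚ e * W′ (t ℕ.+ k)) N ∎
  where
  A  = x + r zero
  W′ = W k es (r ∘ suc) x
  h  = λ s → ι (suc s) ^ℚ e * W′ s
  h-vanishes : ∀ s → s < k → h s ≡ 0ℚ
  h-vanishes s s<k = trans (cong (ι (suc s) ^ℚ e *_) (W-vanishes k es (r ∘ suc) x s s<k)) (ℚP.*-zeroʳ (ι (suc s) ^ℚ e))
  ι-shift : ∀ t → ι (suc (t ℕ.+ k)) ≡ ι t + ι (suc k)
  ι-shift t = trans (cong ι (sym (ℕP.+-suc t k))) (ι-+ t (suc k))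

W-expPoly : ∀ k es r → ExpPoly r (λ (x , N) → W k es r x (N ℕ.+ k))
W-expPoly zero [] r = span-cong pure-power (span-term ([ 1ℚ ] , [ 1ℚ ] , zero))
  where
  pure-power : ∀ d → expTerm r ([ 1ℚ ] , [ 1ℚ ] , zero) d ≡ W zero [] r (proj₁ d) (proj₂ d ℕ.+ 0)
  pure-power (x , N) = trans (simplify x ((x + r zero) ^ℚ N)) (cong ((x + r zero) ^ℚ_) (sym (ℕP.+-identityʳ N)))
    where
    simplify : ∀ x P → (1ℚ * 1ℚ + 0ℚ) * (1ℚ + x * 0ℚ) * P ≡ P
    simplify = solve-∀ ℚ-ring
W-expPoly (suc k) (e ∷ es) r =
  span-cong (λ (x , N) → sym (W-step k e es r x N))
    (expPoly-conv r zero (expPoly-mulNpow r (ι (suc k)) e (expPoly-lift r (W-expPoly k es (r ∘ suc)))))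

substPoly : ∀ {v w} → ℤPoly v → (Fin v → ℤPoly w) → ℤPoly w
substPoly (const c) σ = const c
substPoly (var i)   σ = σ i
substPoly (p ⊕ q)   σ = substPoly p σ ⊕ substPoly q σ
substPoly (p ⊗ q)   σ = substPoly p σ ⊗ substPoly q σ

eval-subst : ∀ {v w} (Q : ℤPoly v) (σ : Fin v → ℤPoly w) ρ →
  evalℤPoly (substPoly Q σ) ρ ≡ evalℤPoly Q (λ j → evalℤPoly (σ j) ρ)
eval-subst (const c) σ ρ = refl
eval-subst (var i)   σ ρ = refl
eval-subst (p ⊕ q)   σ ρ = cong₂ _+_ (eval-subst p σ ρ) (eval-subst q σ ρ)
eval-subst (p ⊗ q)   σ ρ = cong₂ _*_ (eval-subst p σ ρ) (eval-subst q σ ρ)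

eval-cong : ∀ {v} (Q : ℤPoly v) {ρ ρ′} → (∀ j → ρ j ≡ ρ′ j) → evalℤPoly Q ρ ≡ evalℤPoly Q ρ′
eval-cong (const c) eq = refl
eval-cong (var i)   eq = eq i
eval-cong (p ⊕ q)   eq = cong₂ _+_ (eval-cong p eq) (eval-cong q eq)
eval-cong (p ⊗ q)   eq = cong₂ _*_ (eval-cong p eq) (eval-cong q eq)

fromEnd : ℕ → ℕ → ℚ
fromEnd n a = (ι n + 1ℚ) - ι a

fromEnd-+ : ∀ a j → fromEnd (a ℕ.+ j) a ≡ ι (suc j)
fromEnd-+ a j = begin
  (ι (a ℕ.+ j) + 1ℚ) - ι a    ≡⟨ cong (λ v → (v + 1ℚ) - ι a) (ι-+ a j) ⟩
  ((ι a + ι j) + 1ℚ) - ι a    ≡⟨ cancel (ι a) (ι j) ⟩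
  ι j + 1ℚ                    ≡⟨ sym (ι-suc j) ⟩
  ι (suc j)                   ∎
  where
  cancel : ∀ a j → ((a + j) + 1ℚ) - a ≡ j + 1ℚ
  cancel = solve-∀ ℚ-ring

-- The reflection yⱼ ↦ m + 1 - yⱼ (j < k), m ↦ m of the variables y₁, …, y_k, m of Q.
reflectVar : ∀ k → Fin (suc k) → ℤPoly (suc k)
reflectVar zero    zero    = var zero
reflectVar (suc k) zero    = (var (fromℕ (suc k)) ⊕ const (ℤ.+ 1)) ⊕ (const ℤ.-[1+ 0 ] ⊗ var zero)
reflectVar (suc k) (suc j) = substPoly (reflectVar k j) (var ∘ suc)

reflect : ∀ k → ℤPoly (suc k) → ℤPoly (suc k)
reflect k Q = substPoly Q (reflectVar k)

lookup-last : ∀ {A : Set} {k} (xs : Vec A k) y → lookup (xs ∷ʳ y) (fromℕ k) ≡ y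
lookup-last []       y = refl
lookup-last (x ∷ xs) y = lookup-last xs y

eval-reflectVar : ∀ k (xs : Vec ℕ k) n j →
  evalℤPoly (reflectVar k j) (lookup (Vec.map (fromEnd n) xs ∷ʳ ι n)) ≡ ι (lookup (xs ∷ʳ n) j)
eval-reflectVar zero    []       n zero    = refl
eval-reflectVar (suc k) (a ∷ xs) n zero    = begin
  (lookup (Vec.map (fromEnd n) xs ∷ʳ ι n) (fromℕ k) + 1ℚ) + - 1ℚ * fromEnd n a
    ≡⟨ cong (λ v → (v + 1ℚ) + - 1ℚ * fromEnd n a) (lookup-last (Vec.map (fromEnd n) xs) (ι n)) ⟩
  (ι n + 1ℚ) + - 1ℚ * ((ι n + 1ℚ) - ι a)
    ≡⟨ unreflect (ι n) (ι a) ⟩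
  ι a ∎
  where
  unreflect : ∀ m a → (m + 1ℚ) + - 1ℚ * ((m + 1ℚ) - a) ≡ a
  unreflect = solve-∀ ℚ-ring
eval-reflectVar (suc k) (a ∷ xs) n (suc j) =
  trans (eval-subst (reflectVar k j) (var ∘ suc) _) (eval-reflectVar k xs n j)

eval-reflect : ∀ k Q (xs : Vec ℕ k) n →
  evalℤPoly Q (λ j → ι (lookup (xs ∷ʳ n) j)) ≡ evalℤPoly (reflect k Q) (lookup (Vec.map (fromEnd n) xs ∷ʳ ι n))
eval-reflect k Q xs n = trans (eval-cong Q (λ j → sym (eval-reflectVar k xs n j)))
                              (sym (eval-subst Q (reflectVar k) (lookup (Vec.map (fromEnd n) xs ∷ʳ ι n))))

Monomial : ℕ → Set
Monomial v = ℚ × Vec ℕ v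

powerProduct : ∀ {v} → Vec ℕ v → (Fin v → ℚ) → ℚ
powerProduct []       ρ = 1ℚ
powerProduct (e ∷ es) ρ = ρ zero ^ℚ e * powerProduct es (ρ ∘ suc)

evalMonomial : ∀ {v} → Monomial v → (Fin v → ℚ) → ℚ
evalMonomial (c , es) ρ = c * powerProduct es ρ

unitExponent : ∀ {v} → Fin v → Vec ℕ v
unitExponent {suc v} zero    = 1 ∷ Vec.replicate v 0
unitExponent         (suc i) = 0 ∷ unitExponent i

mulMonomial : ∀ {v} → Monomial v → Monomial v → Monomial v
mulMonomial (c , es) (d , fs) = (c * d , Vec.zipWith ℕ._+_ es fs)

expand : ∀ {v} → ℤPoly v → List (Monomial v)
expand {v} (const c) = [ (ℤ→ℚ c , Vec.replicate v 0) ]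
expand     (var i)   = [ (1ℚ , unitExponent i) ]
expand     (p ⊕ q)   = expand p ++ expand q
expand     (p ⊗ q)   = concatMap (λ m → map (mulMonomial m) (expand q)) (expand p)

powerProduct-zero : ∀ v ρ → powerProduct (Vec.replicate v 0) ρ ≡ 1ℚ
powerProduct-zero zero    ρ = refl
powerProduct-zero (suc v) ρ = trans (cong (1ℚ *_) (powerProduct-zero v (ρ ∘ suc))) (ℚP.*-identityˡ 1ℚ)

powerProduct-unit : ∀ {v} (i : Fin v) ρ → powerProduct (unitExponent i) ρ ≡ ρ i
powerProduct-unit {suc v} zero    ρ = trans (cong (ρ zero * 1ℚ *_) (powerProduct-zero v (ρ ∘ suc))) (simplify (ρ zero))
  where
  simplify : ∀ a → a * 1ℚ * 1ℚ ≡ a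
  simplify = solve-∀ ℚ-ring
powerProduct-unit         (suc i) ρ = trans (cong (1ℚ *_) (powerProduct-unit i (ρ ∘ suc))) (ℚP.*-identityˡ _)

powerProduct-+ : ∀ {v} (es fs : Vec ℕ v) ρ →
  powerProduct (Vec.zipWith ℕ._+_ es fs) ρ ≡ powerProduct es ρ * powerProduct fs ρ
powerProduct-+ []       []       ρ = refl
powerProduct-+ (e ∷ es) (f ∷ fs) ρ =
  trans (cong₂ _*_ (^-+ (ρ zero) e f) (powerProduct-+ es fs (ρ ∘ suc)))
        (*-reassoc (ρ zero ^ℚ e) (ρ zero ^ℚ f) (powerProduct es (ρ ∘ suc)) (powerProduct fs (ρ ∘ suc)))

evalMonomial-mul : ∀ {v} (m m′ : Monomial v) ρ →
  evalMonomial (mulMonomial m m′) ρ ≡ evalMonomial m ρ * evalMonomial m′ ρ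
evalMonomial-mul (c , es) (d , fs) ρ =
  trans (cong (c * d *_) (powerProduct-+ es fs ρ)) (*-reassoc c d (powerProduct es ρ) (powerProduct fs ρ))

expand-correct : ∀ {v} (P : ℤPoly v) ρ → evalℤPoly P ρ ≡ sumℚ (map (λ m → evalMonomial m ρ) (expand P))
expand-correct {v} (const c) ρ =
  sym (trans (cong (λ p → ℤ→ℚ c * p + 0ℚ) (powerProduct-zero v ρ)) (simplify (ℤ→ℚ c)))
  where
  simplify : ∀ c → c * 1ℚ + 0ℚ ≡ c
  simplify = solve-∀ ℚ-ring
expand-correct (var i) ρ = sym (trans (cong (λ p → 1ℚ * p + 0ℚ) (powerProduct-unit i ρ)) (simplify (ρ i)))
  where
  simplify : ∀ a → 1ℚ * a + 0ℚ ≡ a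
  simplify = solve-∀ ℚ-ring
expand-correct (p ⊕ q) ρ =
  trans (cong₂ _+_ (expand-correct p ρ) (expand-correct q ρ))
        (sym (sum-++ (λ m → evalMonomial m ρ) (expand p) (expand q)))
expand-correct (p ⊗ q) ρ = sym (begin
  sumℚ (map ev (concatMap (λ m → map (mulMonomial m) (expand q)) (expand p)))
    ≡⟨ sum-concatMap ev (λ m → map (mulMonomial m) (expand q)) (expand p) ⟩
  sumℚ (map (λ m → sumℚ (map ev (map (mulMonomial m) (expand q)))) (expand p))
    ≡⟨ sum-cong products (expand p) ⟩
  sumℚ (map (λ m → ev m * evalℤPoly q ρ) (expand p))
    ≡⟨ sum-*ʳ (evalℤPoly q ρ) ev (expand p) ⟩
  sumℚ (map ev (expand p)) * evalℤPoly q ρ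
    ≡⟨ cong (_* evalℤPoly q ρ) (sym (expand-correct p ρ)) ⟩
  evalℤPoly p ρ * evalℤPoly q ρ ∎)
  where
  ev = λ m → evalMonomial m ρ
  products : ∀ m → sumℚ (map ev (map (mulMonomial m) (expand q))) ≡ ev m * evalℤPoly q ρ
  products m = begin
    sumℚ (map ev (map (mulMonomial m) (expand q)))       ≡⟨ sum-map ev (mulMonomial m) (expand q) ⟩
    sumℚ (map (λ m′ → ev (mulMonomial m m′)) (expand q)) ≡⟨ sum-cong (λ m′ → evalMonomial-mul m m′ ρ) (expand q) ⟩
    sumℚ (map (λ m′ → ev m * ev m′) (expand q))          ≡⟨ sum-*ˡ (ev m) ev (expand q) ⟩
    ev m * sumℚ (map ev (expand q))                      ≡⟨ cong (ev m *_) (sym (expand-correct q ρ)) ⟩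
    ev m * evalℤPoly q ρ                                 ∎

powerProduct-∷ʳ : ∀ {k} (es : Vec ℕ k) e (us : Vec ℚ k) u →
  powerProduct (es ∷ʳ e) (lookup (us ∷ʳ u)) ≡ powerProduct es (lookup us) * u ^ℚ e
powerProduct-∷ʳ []       e []       u = trans (ℚP.*-identityʳ (u ^ℚ e)) (sym (ℚP.*-identityˡ (u ^ℚ e)))
powerProduct-∷ʳ (f ∷ es) e (v ∷ us) u =
  trans (cong (v ^ℚ f *_) (powerProduct-∷ʳ es e us u)) (sym (ℚP.*-assoc (v ^ℚ f) _ _))

gapProduct : ∀ k → (Fin (suc k) → ℚ) → ℚ → ℕ → Vec ℕ k → ℕ → ℚ
gapProduct k r x p xs n = prodFin (suc k) (λ i → (x + r i) ^ℚ (lookup ends (suc i) ∸ lookup ends (inject₁ i) ∸ 1))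
  where
  ends = p ∷ (xs ∷ʳ suc n)

-- Σ_{p < x₁ < … < x_k ≤ n} ∏ⱼ (n + 1 - xⱼ)^(eⱼ) · gapProduct: the sum in M for one monomial.
gapSum : ∀ k → Vec ℕ k → (Fin (suc k) → ℚ) → ℚ → ℕ → ℕ → ℚ
gapSum k es r x p n =
  sumℚ (map (λ xs → powerProduct es (lookup (Vec.map (fromEnd n) xs)) * gapProduct k r x p xs n) (incSeqs k (suc p) n))

gapSum-peel : ∀ k e es r x p n → gapSum (suc k) (e ∷ es) r x p n
  ≡ sumℚ (map (λ a → fromEnd n a ^ℚ e * (x + r zero) ^ℚ (a ∸ p ∸ 1) * gapSum k es (r ∘ suc) x a n) (range (suc p) n))
gapSum-peel k e es r x p n =
  trans (sum-concatMap summand (λ a → map (a ∷_) (incSeqs k (suc a) n)) (range (suc p) n))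
        (sum-cong first-index (range (suc p) n))
  where
  summand = λ xs → powerProduct (e ∷ es) (lookup (Vec.map (fromEnd n) xs)) * gapProduct (suc k) r x p xs n
  first-index : ∀ a → sumℚ (map summand (map (a ∷_) (incSeqs k (suc a) n)))
                    ≡ fromEnd n a ^ℚ e * (x + r zero) ^ℚ (a ∸ p ∸ 1) * gapSum k es (r ∘ suc) x a n
  first-index a = begin
    sumℚ (map summand (map (a ∷_) (incSeqs k (suc a) n)))
      ≡⟨ sum-map summand (a ∷_) (incSeqs k (suc a) n) ⟩
    sumℚ (map (λ xs → (U * P xs) * (G * Q xs)) (incSeqs k (suc a) n))
      ≡⟨ sum-cong (λ xs → *-reassoc U (P xs) G (Q xs)) (incSeqs k (suc a) n) ⟩
    sumℚ (map (λ xs → (U * G) * (P xs * Q xs)) (incSeqs k (suc a) n))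
      ≡⟨ sum-*ˡ (U * G) (λ xs → P xs * Q xs) (incSeqs k (suc a) n) ⟩
    U * G * gapSum k es (r ∘ suc) x a n ∎
    where
    U = fromEnd n a ^ℚ e
    G = (x + r zero) ^ℚ (a ∸ p ∸ 1)
    P = λ xs → powerProduct es (lookup (Vec.map (fromEnd n) xs))
    Q = λ xs → gapProduct k (r ∘ suc) x a xs n

gapSum-as-sumUpTo : ∀ k e es r x p R → gapSum (suc k) (e ∷ es) r x p (p ℕ.+ R)
  ≡ sumUpTo R (λ i → fromEnd (p ℕ.+ R) (suc p ℕ.+ i) ^ℚ e * (x + r zero) ^ℚ (suc p ℕ.+ i ∸ p ∸ 1)
                     * gapSum k es (r ∘ suc) x (suc p ℕ.+ i) (p ℕ.+ R))
gapSum-as-sumUpTo k e es r x p R = begin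
  gapSum (suc k) (e ∷ es) r x p (p ℕ.+ R)            ≡⟨ gapSum-peel k e es r x p (p ℕ.+ R) ⟩
  sumℚ (map g (range (suc p) (p ℕ.+ R)))              ≡⟨ sum-range g (suc p) (p ℕ.+ R) ⟩
  sumUpTo (p ℕ.+ R ∸ p) (λ i → g (suc p ℕ.+ i))       ≡⟨ cong (λ m → sumUpTo m (λ i → g (suc p ℕ.+ i))) (ℕP.m+n∸m≡n p R) ⟩
  sumUpTo R (λ i → g (suc p ℕ.+ i))                   ∎
  where
  g = λ a → fromEnd (p ℕ.+ R) a ^ℚ e * (x + r zero) ^ℚ (a ∸ p ∸ 1) * gapSum k es (r ∘ suc) x a (p ℕ.+ R)

gapSum-W : ∀ k es r x p R → gapSum k es r x p (p ℕ.+ R) ≡ W k es r x R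
gapSum-W zero [] r x p R = begin   -- the only sequence is the empty one
  1ℚ * ((x + r zero) ^ℚ (suc (p ℕ.+ R) ∸ p ∸ 1) * 1ℚ) + 0ℚ
    ≡⟨ cong (λ m → 1ℚ * ((x + r zero) ^ℚ m * 1ℚ) + 0ℚ) gap ⟩
  1ℚ * ((x + r zero) ^ℚ R * 1ℚ) + 0ℚ
    ≡⟨ simplify ((x + r zero) ^ℚ R) ⟩
  (x + r zero) ^ℚ R ∎
  where
  gap : suc (p ℕ.+ R) ∸ p ∸ 1 ≡ R
  gap = cong (_∸ 1) (trans (cong (_∸ p) (sym (ℕP.+-suc p R))) (ℕP.m+n∸m≡n p (suc R)))
  simplify : ∀ a → 1ℚ * (a * 1ℚ) + 0ℚ ≡ a
  simplify = solve-∀ ℚ-ring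
gapSum-W (suc k) (e ∷ es) r x p zero    = gapSum-as-sumUpTo k e es r x p zero
gapSum-W (suc k) (e ∷ es) r x p (suc R) = begin
  gapSum (suc k) (e ∷ es) r x p n
    ≡⟨ gapSum-as-sumUpTo k e es r x p (suc R) ⟩
  sumUpTo (suc R) (λ i → peelTerm (suc p ℕ.+ i))
    ≡⟨ sumUpTo-cong (suc R) (λ i i<1+R → convolution-term i (ℕP.≤-pred i<1+R)) ⟩
  sumUpTo (suc R) (λ i → A ^ℚ i * h (R ∸ i))
    ≡⟨ conv-as-sum A h R ⟩
  conv A h R ∎
  where
  n = p ℕ.+ suc R
  A = x + r zero
  h = λ s → ι (suc s) ^ℚ e * W k es (r ∘ suc) x s
  peelTerm = λ a → fromEnd n a ^ℚ e * A ^ℚ (a ∸ p ∸ 1) * gapSum k es (r ∘ suc) x a n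
  -- The index a = p + 1 + i leaves room R - i to the right.
  convolution-term : ∀ i → i ≤ R → peelTerm (suc p ℕ.+ i) ≡ A ^ℚ i * h (R ∸ i)
  convolution-term i i≤R = begin
    fromEnd n a ^ℚ e * A ^ℚ (a ∸ p ∸ 1) * gapSum k es (r ∘ suc) x a n
      ≡⟨ cong (λ m → fromEnd m a ^ℚ e * A ^ℚ (a ∸ p ∸ 1) * gapSum k es (r ∘ suc) x a m) n≡a+j ⟩
    fromEnd (a ℕ.+ j) a ^ℚ e * A ^ℚ (a ∸ p ∸ 1) * gapSum k es (r ∘ suc) x a (a ℕ.+ j)
      ≡⟨ cong₂ (λ u v → u ^ℚ e * A ^ℚ v * gapSum k es (r ∘ suc) x a (a ℕ.+ j)) (fromEnd-+ a j) gap ⟩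
    ι (suc j) ^ℚ e * A ^ℚ i * gapSum k es (r ∘ suc) x a (a ℕ.+ j)
      ≡⟨ cong (ι (suc j) ^ℚ e * A ^ℚ i *_) (gapSum-W k es (r ∘ suc) x a j) ⟩
    ι (suc j) ^ℚ e * A ^ℚ i * W k es (r ∘ suc) x j
      ≡⟨ swap (ι (suc j) ^ℚ e) (A ^ℚ i) (W k es (r ∘ suc) x j) ⟩
    A ^ℚ i * h j ∎
    where
    a = suc p ℕ.+ i
    j = R ∸ i
    gap : a ∸ p ∸ 1 ≡ i
    gap = cong (_∸ 1) (trans (cong (_∸ p) (sym (ℕP.+-suc p i))) (ℕP.m+n∸m≡n p (suc i)))
    n≡a+j : n ≡ a ℕ.+ j
    n≡a+j = begin
      p ℕ.+ suc R              ≡⟨ ℕP.+-suc p R ⟩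
      suc (p ℕ.+ R)            ≡⟨ cong (λ m → suc (p ℕ.+ m)) (sym (ℕP.m+[n∸m]≡n i≤R)) ⟩
      suc (p ℕ.+ (i ℕ.+ j))    ≡⟨ cong suc (sym (ℕP.+-assoc p i j)) ⟩
      a ℕ.+ j                  ∎
    swap : ∀ u q w → u * q * w ≡ q * (u * w)
    swap = solve-∀ ℚ-ring

M-expansion : ∀ k Q r n x →
  M k Q r n x ≡ sumℚ (map (λ (c , e) → c * ι n ^ℚ last e * W k (init e) r x n) (expand (reflect k Q)))
M-expansion k Q r n x = begin
  sumℚ (map (λ xs → evalℤPoly Q (λ j → ι (lookup (xs ∷ʳ n) j)) * gaps xs) L)
    ≡⟨ sum-cong per-sequence L ⟩
  sumℚ (map (λ xs → sumℚ (map (λ m → term m xs) ms)) L)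
    ≡⟨ sum-swap (λ xs m → term m xs) L ms ⟩
  sumℚ (map (λ m → sumℚ (map (term m) L)) ms)
    ≡⟨ sum-cong (λ (c , e) → sum-*ˡ (c * ι n ^ℚ last e) (monomialSummand (init e)) L) ms ⟩
  sumℚ (map (λ (c , e) → c * ι n ^ℚ last e * gapSum k (init e) r x 0 n) ms)
    ≡⟨ sum-cong (λ (c , e) → cong (c * ι n ^ℚ last e *_) (gapSum-W k (init e) r x 0 n)) ms ⟩
  sumℚ (map (λ (c , e) → c * ι n ^ℚ last e * W k (init e) r x n) ms) ∎
  where
  L    = incSeqs k 1 n
  ms   = expand (reflect k Q)
  gaps = λ xs → gapProduct k r x 0 xs n
  us   = λ xs → Vec.map (fromEnd n) xs
  monomialSummand = λ es xs → powerProduct es (lookup (us xs)) * gaps xs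
  term : Monomial (suc k) → Vec ℕ k → ℚ
  term (c , e) xs = c * ι n ^ℚ last e * monomialSummand (init e) xs
  per-sequence : ∀ xs → evalℤPoly Q (λ j → ι (lookup (xs ∷ʳ n) j)) * gaps xs ≡ sumℚ (map (λ m → term m xs) ms)
  per-sequence xs = begin
    evalℤPoly Q (λ j → ι (lookup (xs ∷ʳ n) j)) * gaps xs
      ≡⟨ cong (_* gaps xs) (trans (eval-reflect k Q xs n) (expand-correct (reflect k Q) ρ)) ⟩
    sumℚ (map (λ m → evalMonomial m ρ) ms) * gaps xs
      ≡⟨ sym (sum-*ʳ (gaps xs) (λ m → evalMonomial m ρ) ms) ⟩
    sumℚ (map (λ m → evalMonomial m ρ * gaps xs) ms)
      ≡⟨ sum-cong split-last ms ⟩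
    sumℚ (map (λ m → term m xs) ms) ∎
    where
    ρ = lookup (us xs ∷ʳ ι n)
    split-last : ∀ m → evalMonomial m ρ * gaps xs ≡ term m xs
    split-last (c , e) = begin
      c * powerProduct e ρ * gaps xs
        ≡⟨ cong (λ e′ → c * powerProduct e′ ρ * gaps xs) (proj₂ (proj₂ (initLast e))) ⟩
      c * powerProduct (init e ∷ʳ last e) ρ * gaps xs
        ≡⟨ cong (λ v → c * v * gaps xs) (powerProduct-∷ʳ (init e) (last e) (us xs) (ι n)) ⟩
      c * (powerProduct (init e) (lookup (us xs)) * ι n ^ℚ last e) * gaps xs
        ≡⟨ regroup c (powerProduct (init e) (lookup (us xs))) (ι n ^ℚ last e) (gaps xs) ⟩
      c * ι n ^ℚ last e * (powerProduct (init e) (lookup (us xs)) * gaps xs) ∎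
      where
      regroup : ∀ c p q g → c * (p * q) * g ≡ c * q * (p * g)
      regroup = solve-∀ ℚ-ring

ClosedTerm : ℕ → Set
ClosedTerm k = ℚPoly × ℚPoly × Fin (suc k)

closedTerm : ∀ k → (Fin (suc k) → ℚ) → ClosedTerm k → Σ ℕ (k ≤_) × ℚ → ℚ
closedTerm k r (F , G , i) ((n , _) , x) = evalℚPoly F (ℕ→ℚ n) * evalℚPoly G x * ((x + r i) ^ℚ (n ∸ k))

-- If g(x, N + k) is an exponential polynomial, then c n^e g(x, n) has the closed form
-- of the statement: substitute N = n - k and convert F to the monomial basis in n.
closedForm : ∀ k r c e (g : ℚ → ℕ → ℚ) → ExpPoly r (λ (x , N) → g x (N ℕ.+ k)) →
  InSpan (closedTerm k r) (λ ((n , _) , x) → c * ι n ^ℚ e * g x n)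
closedForm k r c e g p =
  span-cong (λ ((n , k≤n) , x) → cong (λ m → c * ι n ^ℚ e * g x m) (ℕP.m∸n+n≡m k≤n))
    (span-map toClosed (λ ((n , _) , x) → (x , n ∸ k)) (λ ((n , _) , _) → c * ι n ^ℚ e) toClosed-eq p)
  where
  toClosed : ExpTerm (suc k) → ClosedTerm k
  toClosed (F , G , i) = (scalePoly c (replicate e 0ℚ ++ toMonomialFrom k 0 F) , G , i)
  toClosed-eq : ∀ τ d → closedTerm k r (toClosed τ) d
                      ≡ c * ι (proj₁ (proj₁ d)) ^ℚ e * expTerm r τ (proj₂ d , proj₁ (proj₁ d) ∸ k)
  toClosed-eq (F , G , i) ((n , k≤n) , x) = begin
    evalℚPoly (scalePoly c (replicate e 0ℚ ++ toMonomialFrom k 0 F)) (ι n) * γ * P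
      ≡⟨ cong (λ v → v * γ * P) (eval-scalePoly c (replicate e 0ℚ ++ toMonomialFrom k 0 F) (ι n)) ⟩
    c * evalℚPoly (replicate e 0ℚ ++ toMonomialFrom k 0 F) (ι n) * γ * P
      ≡⟨ cong (λ v → c * v * γ * P) (eval-shiftUp e (toMonomialFrom k 0 F) (ι n)) ⟩
    c * (ι n ^ℚ e * evalℚPoly (toMonomialFrom k 0 F) (ι n)) * γ * P
      ≡⟨ cong (λ m → c * (ι n ^ℚ e * evalℚPoly (toMonomialFrom k 0 F) (ι m)) * γ * P) (sym (ℕP.m∸n+n≡m k≤n)) ⟩
    c * (ι n ^ℚ e * evalℚPoly (toMonomialFrom k 0 F) (ι (n ∸ k ℕ.+ k))) * γ * P
      ≡⟨ cong (λ v → c * (ι n ^ℚ e * v) * γ * P) (eval-toMonomialFrom k 0 F (n ∸ k)) ⟩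
    c * (ι n ^ℚ e * evalBin F (n ∸ k)) * γ * P
      ≡⟨ regroup c (ι n ^ℚ e) (evalBin F (n ∸ k)) γ P ⟩
    c * ι n ^ℚ e * (evalBin F (n ∸ k) * γ * P) ∎
    where
    γ = evalℚPoly G x
    P = (x + r i) ^ℚ (n ∸ k)
    regroup : ∀ c q f g P → c * (q * f) * g * P ≡ c * q * (f * g * P)
    regroup = solve-∀ ℚ-ring

lemma6p2 : (k : ℕ) (Q : ℤPoly (suc k)) (r : Fin (suc k) → ℚ) →
    ∃ λ (terms : List (ℚPoly × ℚPoly × Fin (suc k))) →
      (n : ℕ) → k ≤ n → (x : ℚ) →
        M k Q r n x ≡ sumℚ (map (λ { (F , G , i) → evalℚPoly F (ℕ→ℚ n) * evalℚPoly G x * ((x + r i) ^ℚ (n ∸ k)) }) terms)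
lemma6p2 k Q r = terms , λ n k≤n x → represents ((n , k≤n) , x)
  where
  M-closed : InSpan (closedTerm k r) (λ ((n , _) , x) → M k Q r n x)
  M-closed = span-cong (λ ((n , _) , x) → sym (M-expansion k Q r n x))
    (span-sum (expand (reflect k Q))
      (λ (c , e) → closedForm k r c (last e) (λ x n → W k (init e) r x n) (W-expPoly k (init e) r)))
  open InSpan M-closed
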